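{- For the elementary cellular automaton $F_{152}$ and every nonempty finite word $u\in\{0,1\}^*$, $D(\textsc{SInv}_{F_{152},u,n})\in O(1)$ as $n\to\infty$.
   Context: The ECA with Wolfram number $N$ is $F_N:\{0,1\}^{\mathbb{Z}}\to\{0,1\}^{\mathbb{Z}}$, $(F_N(x))_i=f_N(x_{i-1},x_i,x_{i+1})$, where $f_N(a,b,c)$ is the bit of index $4a+2b+c$ of $N$ in binary. For a nonempty word $u$, $p_u\in\{0,1\}^{\mathbb{Z}}$ is $(p_u)_i=u_{i\bmod |u|}$; for a finite word $x$, $p_u[x]$ equals $x$ on positions $\{0,\dots,|x|-1\}$ and $p_u$ elsewhere. $\textsc{SInv}_{F,u,n}:\{0,1\}^n\to\{0,1\}$ maps $x$ to $1$ iff there is an integer $w$ such that for every $t\ge 0$ the set of positions where $F^t(p_u)$ and $F^t(p_u[x])$ differ is contained in an interval of length $w$. For finite sets $X,Y,Z$ and $g:X\times Y\to Z$, $D(g)$ is the minimal depth of a deterministic two-party communication protocol tree computing $g$ (Alice knows $x$, Bob knows $y$; internal nodes are labelled by a function of $x$ alone or of $y$ alone to $\{\mathrm{l},\mathrm{r}\}$, leaves by outputs). For $g:\{0,1\}^m\to Z$, $D(g)=\max_{0\le i\le m} D(g_i)$ with $g_i(x,y)=g(xy)$ for $x\in\{0,1\}^i$, $y\in\{0,1\}^{m-i}$. -}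

module Defs where

open import Data.Bool using (Bool; true; false)
open import Data.Nat as ℕ using (ℕ; zero; suc; _<?_)
open import Data.Nat.DivMod using (_/_; _%_)
open import Data.Integer as ℤ using (ℤ; +_; -[1+_]; _≤_; _<_)
open import Data.Integer.DivMod using (_%ℕ_; n%ℕd<d)
open import Data.Fin using (Fin; fromℕ<)
open import Data.Vec using (Vec; lookup; _++_)
open import Data.Product using (Σ; ∃; ∃-syntax; _×_)
open import Relation.Binary.PropositionalEquality using (_≡_; _≢_)
open import Relation.Nullary using (yes; no)
open import Function.Bundles using (_⇔_)

-- Configurations of {0,1}^ℤ (0 = false, 1 = true).
Config : Set
Config = ℤ → Bool

bitval : Bool → ℕ
bitval false = 0
bitval true  = 1

testBit : ℕ → ℕ → Bool
testBit N zero with N % 2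
... | zero  = false
... | suc _ = true
testBit N (suc k) = testBit (N / 2) k

localRule : ℕ → Bool → Bool → Bool → Bool
localRule N a b c = testBit N (4 ℕ.* bitval a ℕ.+ 2 ℕ.* bitval b ℕ.+ bitval c)

ECA : ℕ → Config → Config
ECA N x i = localRule N (x (i ℤ.- + 1)) (x i) (x (i ℤ.+ + 1))

iter : (Config → Config) → ℕ → Config → Config
iter F zero    x = x
iter F (suc t) x = F (iter F t x)

periodic : ∀ {k} → Vec Bool (suc k) → Config
periodic {k} u i = lookup u (fromℕ< (n%ℕd<d i (suc k)))

patch : ∀ {k n} → Vec Bool (suc k) → Vec Bool n → Config
patch {n = n} u x (+ m) with m <? n
... | yes m<n = lookup x (fromℕ< m<n)
... | no  _   = periodic u (+ m)
patch u x -[1+ m ] = periodic u -[1+ m ]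

-- The predicate underlying SInv_{F,u,n}(x) = 1: there is w such that for all t
-- the set of differing positions of F^t(p_u) and F^t(p_u[x]) lies in an
-- interval {a, …, a+w-1} of length w.
SInvP : (Config → Config) → ∀ {k} → Vec Bool (suc k) → ∀ {n} → Vec Bool n → Set
SInvP F u x =
  ∃[ w ] ∀ (t : ℕ) → ∃[ a ] ∀ (i : ℤ) →
    iter F t (periodic u) i ≢ iter F t (patch u x) i →
    (a ≤ i) × (i < a ℤ.+ + w)

data Protocol (X Y Z : Set) : Set where
  leaf  : Z → Protocol X Y Z
  alice : (X → Bool) → Protocol X Y Z → Protocol X Y Z → Protocol X Y Z
  bob   : (Y → Bool) → Protocol X Y Z → Protocol X Y Z → Protocol X Y Z

eval : ∀ {X Y Z} → Protocol X Y Z → X → Y → Z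
eval (leaf z)      x y = z
eval (alice f l r) x y with f x
... | true  = eval l x y
... | false = eval r x y
eval (bob g l r)   x y with g y
... | true  = eval l x y
... | false = eval r x y

depth : ∀ {X Y Z} → Protocol X Y Z → ℕ
depth (leaf _)      = 0
depth (alice _ l r) = suc (depth l ℕ.⊔ depth r)
depth (bob _ l r)   = suc (depth l ℕ.⊔ depth r)

-- D(SInv_{F,u,i+j} split as (i,j)) ≤ c : some protocol of depth ≤ c computes
-- the Boolean function x,y ↦ SInv(x ++ y), i.e. outputs true iff SInvP holds.
SInvSplitD≤ : (Config → Config) → ∀ {k} → Vec Bool (suc k) → ℕ → ℕ → ℕ → Set
SInvSplitD≤ F u i j c =
  ∃[ P ] (depth {Vec Bool i} {Vec Bool j} {Bool} P ℕ.≤ c) ×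
    (∀ x y → (eval P x y ≡ true) ⇔ SInvP F u (x ++ y))

-- D(SInv_{F,u,n}) ≤ c  (max over all split points i + j = n).
SInvD≤ : (Config → Config) → ∀ {k} → Vec Bool (suc k) → ℕ → ℕ → Set
SInvD≤ F u n c = ∀ i j → i ℕ.+ j ≡ n → SInvSplitD≤ F u i j c

-- Rule 152 sends a cell to 1 exactly on the neighbourhoods 111, 100 and 011: the last
-- one of every run of ones dies, and a one followed by two zeros moves one cell right.
-- If u contains a zero, both p_u and p_u[x] have a zero in every block of 2|u| + n
-- cells, so their runs of ones shorten step by step until every one is followed by two
-- zeros; from then on both configurations are merely translated. The difference,
-- confined to a light cone until that time, therefore stays in a window of fixed width,
-- and SInv is constantly 1. If u = 1…1, then SInv(x) holds iff x = 1…1: otherwise the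
-- leftmost zero of p_u[x] travels left forever while the rightmost one stays put. In
-- either case a protocol in which each party sends at most one bit decides SInv.

module Submission where

open import Defs
open import Data.Bool using (Bool; true; false)
import Data.Bool.Properties as Bool
open import Data.Empty using (⊥-elim)
open import Data.Fin using (zero; suc; toℕ; fromℕ<)
import Data.Fin.Properties as Fin
open import Data.Integer as ℤ using (ℤ; +_; -[1+_]; _+_; _-_; -_; _*_)
import Data.Integer.Properties as ℤ
open import Data.Integer.DivMod using (_%ℕ_; _/ℕ_; n%ℕd<d; a≡a%ℕn+[a/ℕn]*n)
open import Data.Integer.Tactic.RingSolver using (solve-∀)
open import Data.Nat as ℕ using (ℕ; zero; suc; z≤n; s≤s; s≤s⁻¹; _∸_; _<?_; _≥_)
import Data.Nat.Properties as ℕ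
open import Data.Nat.DivMod using (_%_; n%n≡0; m<n⇒m%n≡m; [m+kn]%n≡m%n)
import Data.Nat.Tactic.RingSolver as ℕ-Solver
open import Data.Product using (∃-syntax; _×_; _,_; proj₁; proj₂)
open import Data.Sum using (_⊎_; inj₁; inj₂)
open import Data.Vec using (Vec; []; _∷_; lookup; _++_)
open import Data.Vec.Relation.Unary.All using (All; []; _∷_; all?)
import Data.Vec.Relation.Unary.All.Properties as All
open import Function using (_∘_; _$_; _⇔_; mk⇔)
import Function.Properties.Equivalence as ⇔
open import Relation.Binary.PropositionalEquality
open import Relation.Nullary using (yes; no; does; ¬_; contradiction)
open import Relation.Unary using (Pred; Decidable)

F₁₅₂ : Config → Config
F₁₅₂ = ECA 152

reindex : ∀ (e : Config) {i j b} → i ≡ j → e i ≡ b → e j ≡ b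
reindex e refl e[i]≡b = e[i]≡b

private
  [i-1]+1≡i : ∀ i → (i - + 1) + + 1 ≡ i
  [i-1]+1≡i = solve-∀
  [i+1]-1≡i : ∀ i → (i + + 1) - + 1 ≡ i
  [i+1]-1≡i = solve-∀
  [i-1]+2≡i+1 : ∀ i → (i - + 1) + + 2 ≡ i + + 1
  [i-1]+2≡i+1 = solve-∀
  [i+2]-1≡i+1 : ∀ i → (i + + 2) - + 1 ≡ i + + 1
  [i+2]-1≡i+1 = solve-∀
  [i+j]+1≡i+[1+j] : ∀ i j → (i + j) + + 1 ≡ i + (+ 1 + j)
  [i+j]+1≡i+[1+j] = solve-∀
  [i-1]-j≡i-[1+j] : ∀ i j → (i - + 1) - j ≡ i - (+ 1 + j)
  [i-1]-j≡i-[1+j] = solve-∀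
  [i-j]-1≡i-[1+j] : ∀ i j → (i - j) - + 1 ≡ i - (+ 1 + j)
  [i-j]-1≡i-[1+j] = solve-∀
  [i-j]+j≡i : ∀ i j → (i - j) + j ≡ i
  [i-j]+j≡i = solve-∀

ECA-at : ∀ N (e : Config) i {a b c} →
         e (i - + 1) ≡ a → e i ≡ b → e (i + + 1) ≡ c → ECA N e i ≡ localRule N a b c
ECA-at N e i refl refl refl = refl

ECA-diff : ∀ N (d c : Config) i → ECA N d i ≢ ECA N c i →
           d (i - + 1) ≢ c (i - + 1) ⊎ d i ≢ c i ⊎ d (i + + 1) ≢ c (i + + 1)
ECA-diff N d c i d≢c
  with d (i - + 1) Bool.≟ c (i - + 1) | d i Bool.≟ c i | d (i + + 1) Bool.≟ c (i + + 1)
... | no ≢ₗ | _     | _     = inj₁ ≢ₗ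
... | yes _ | no ≢ₘ | _     = inj₂ (inj₁ ≢ₘ)
... | yes _ | yes _ | no ≢ᵣ = inj₂ (inj₂ ≢ᵣ)
... | yes l | yes m | yes r = contradiction (ECA-at N d i l m r) d≢c

iter-+ : ∀ (F : Config → Config) s t e → iter F (s ℕ.+ t) e ≡ iter F s (iter F t e)
iter-+ F zero    t e = refl
iter-+ F (suc s) t e = cong F (iter-+ F s t e)

iter-∸ : ∀ (F : Config → Config) {s t} → s ℕ.≤ t → ∀ e → iter F t e ≡ iter F (t ∸ s) (iter F s e)
iter-∸ F {s} {t} s≤t e = trans (cong (λ t → iter F t e) (sym (ℕ.m∸n+n≡m s≤t))) (iter-+ F (t ∸ s) s e)

F₁₅₂-·10 : ∀ e i → e i ≡ true → e (i + + 1) ≡ false → F₁₅₂ e i ≡ false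
F₁₅₂-·10 e i e[i]≡1 e[i+1]≡0 = trans (ECA-at 152 e i refl e[i]≡1 e[i+1]≡0) (rule (e (i - + 1)))
  where rule : ∀ a → localRule 152 a true false ≡ false
        rule true  = refl
        rule false = refl

F₁₅₂-·01 : ∀ e i → e i ≡ false → e (i + + 1) ≡ true → F₁₅₂ e i ≡ false
F₁₅₂-·01 e i e[i]≡0 e[i+1]≡1 = trans (ECA-at 152 e i refl e[i]≡0 e[i+1]≡1) (rule (e (i - + 1)))
  where rule : ∀ a → localRule 152 a false true ≡ false
        rule true  = refl
        rule false = refl

F₁₅₂-·11 : ∀ e i → e i ≡ true → e (i + + 1) ≡ true → F₁₅₂ e i ≡ true
F₁₅₂-·11 e i e[i]≡1 e[i+1]≡1 = trans (ECA-at 152 e i refl e[i]≡1 e[i+1]≡1) (rule (e (i - + 1)))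
  where rule : ∀ a → localRule 152 a true true ≡ true
        rule true  = refl
        rule false = refl

F₁₅₂-00· : ∀ e i → e (i - + 1) ≡ false → e i ≡ false → F₁₅₂ e i ≡ false
F₁₅₂-00· e i e[i-1]≡0 e[i]≡0 = trans (ECA-at 152 e i e[i-1]≡0 e[i]≡0 refl) (rule (e (i + + 1)))
  where rule : ∀ c → localRule 152 false false c ≡ false
        rule true  = refl
        rule false = refl

F₁₅₂-shift : ∀ e i → (e (i - + 1) ≡ true → e i ≡ false × e (i + + 1) ≡ false) →
             (e i ≡ true → e (i + + 1) ≡ false) → F₁₅₂ e i ≡ e (i - + 1)
F₁₅₂-shift e i = rule (e (i - + 1)) (e i) (e (i + + 1))
  where rule : ∀ a b c → (a ≡ true → b ≡ false × c ≡ false) → (b ≡ true → c ≡ false) →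
               localRule 152 a b c ≡ a
        rule true  _     _     left _   with refl , refl ← left refl = refl
        rule false true  _     _    mid with refl ← mid refl = refl
        rule false false true  _    _   = refl
        rule false false false _    _   = refl

F₁₅₂≡1 : ∀ e i → F₁₅₂ e i ≡ true →
         (e i ≡ true × e (i + + 1) ≡ true) ⊎ (e (i - + 1) ≡ true × e i ≡ false × e (i + + 1) ≡ false)
F₁₅₂≡1 e i = rule (e (i - + 1)) (e i) (e (i + + 1))
  where rule : ∀ a b c → localRule 152 a b c ≡ true →
               (b ≡ true × c ≡ true) ⊎ (a ≡ true × b ≡ false × c ≡ false)
        rule _     true  true  _ = inj₁ (refl , refl)
        rule true  false false _ = inj₂ (refl , refl , refl)
        rule true  true  false ()
        rule false true  false ()
        rule true  false true  ()
        rule false false true  ()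
        rule false false false ()

-- Windows and light cones

record InWindow (a : ℤ) (w : ℕ) (i : ℤ) : Set where
  constructor window
  field
    offset   : ℕ
    offset<w : offset ℕ.< w
    position : i ≡ a + + offset

DiffWithin : Config → Config → ℤ → ℕ → Set
DiffWithin d c a w = ∀ i → d i ≢ c i → InWindow a w i

inWindow⇒bounds : ∀ {a w i} → InWindow a w i → a ℤ.≤ i × i ℤ.< a + + w
inWindow⇒bounds {a} (window k k<w refl) = ℤ.i≤i+j a (+ k) , ℤ.+-monoʳ-< a (ℤ.+<+ k<w)

inWindow-widen : ∀ {a w w′ i} → w ℕ.≤ w′ → InWindow a w i → InWindow a w′ i
inWindow-widen w≤w′ (window k k<w i≡a+k) = window k (ℕ.<-≤-trans k<w w≤w′) i≡a+k

¬inWindow-beyond : ∀ {a w} k → ¬ InWindow a w (a + + w + + k)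
¬inWindow-beyond {a} {w} k in-window =
  ℤ.<⇒≱ (proj₂ (inWindow⇒bounds in-window)) (ℤ.i≤i+j (a + + w) (+ k))

lightcone-step : ∀ N {d c a w} → DiffWithin d c a w →
                 DiffWithin (ECA N d) (ECA N c) (a - + 1) (2 ℕ.+ w)
lightcone-step N {d} {c} {a} diff i d≢c with ECA-diff N d c i d≢c
... | inj₁ ≢ₗ with window k k<w eq ← diff _ ≢ₗ =
  window (suc (suc k)) (s≤s (s≤s k<w)) $
  trans (sym ([i-1]+1≡i i)) (trans (cong (_+ + 1) eq) (shiftₗ a (+ k)))
  where shiftₗ : ∀ a k → (a + k) + + 1 ≡ (a - + 1) + (+ 2 + k)
        shiftₗ = solve-∀
... | inj₂ (inj₁ ≢ₘ) with window k k<w eq ← diff _ ≢ₘ =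
  window (suc k) (s≤s (ℕ.m<n⇒m<1+n k<w)) (trans eq (shiftₘ a (+ k)))
  where shiftₘ : ∀ a k → a + k ≡ (a - + 1) + (+ 1 + k)
        shiftₘ = solve-∀
... | inj₂ (inj₂ ≢ᵣ) with window k k<w eq ← diff _ ≢ᵣ =
  window k (ℕ.m<n⇒m<1+n (ℕ.m<n⇒m<1+n k<w)) $
  trans (sym ([i+1]-1≡i i)) (trans (cong (_- + 1) eq) (shiftᵣ a (+ k)))
  where shiftᵣ : ∀ a k → (a + k) - + 1 ≡ (a - + 1) + k
        shiftᵣ = solve-∀

lightcone : ∀ N {d c a w} → DiffWithin d c a w →
            ∀ t → DiffWithin (iter (ECA N) t d) (iter (ECA N) t c) (a - + t) (w ℕ.+ 2 ℕ.* t)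
lightcone N {a = a} {w} diff zero = subst₂ (DiffWithin _ _) (sym (ℤ.+-identityʳ a)) (sym (ℕ.+-identityʳ w)) diff
lightcone N {a = a} {w} diff (suc t) =
  subst₂ (DiffWithin _ _) ([i-j]-1≡i-[1+j] a (+ t)) (width w t) (lightcone-step N (lightcone N diff t))
  where width : ∀ w t → 2 ℕ.+ (w ℕ.+ 2 ℕ.* t) ≡ w ℕ.+ 2 ℕ.* suc t
        width = ℕ-Solver.solve-∀

-- Sparse configurations

Isolated : Config → Set
Isolated e = ∀ i → e i ≡ true → e (i + + 1) ≡ false

Sparse : Config → Set
Sparse e = ∀ i → e i ≡ true → e (i + + 1) ≡ false × e (i + + 2) ≡ false

sparse-shift : ∀ {e} → Sparse e → ∀ i → F₁₅₂ e i ≡ e (i - + 1)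
sparse-shift {e} sparse i = F₁₅₂-shift e i left (proj₁ ∘ sparse i)
  where
    left : e (i - + 1) ≡ true → e i ≡ false × e (i + + 1) ≡ false
    left e[i-1]≡1 with e[i]≡0 , e[i+1]≡0 ← sparse _ e[i-1]≡1 =
      reindex e ([i-1]+1≡i i) e[i]≡0 , reindex e ([i-1]+2≡i+1 i) e[i+1]≡0

sparse-step : ∀ {e} → Sparse e → Sparse (F₁₅₂ e)
sparse-step {e} sparse i Fe[i]≡1 =
  let e[i]≡0 , e[i+1]≡0 = sparse (i - + 1) (trans (sym (sparse-shift sparse i)) Fe[i]≡1) in
  trans (sparse-shift sparse (i + + 1)) (reindex e (trans ([i-1]+1≡i i) (sym ([i+1]-1≡i i))) e[i]≡0) ,
  trans (sparse-shift sparse (i + + 2)) (reindex e (trans ([i-1]+2≡i+1 i) (sym ([i+2]-1≡i+1 i))) e[i+1]≡0)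

iter-sparse : ∀ {e} → Sparse e → ∀ s → Sparse (iter F₁₅₂ s e)
iter-sparse sparse zero    = sparse
iter-sparse sparse (suc s) = sparse-step (iter-sparse sparse s)

iter-sparse-shift : ∀ {e} → Sparse e → ∀ s i → iter F₁₅₂ s e i ≡ e (i - + s)
iter-sparse-shift {e} sparse zero    i = cong e (sym (ℤ.+-identityʳ i))
iter-sparse-shift {e} sparse (suc s) i = begin
  F₁₅₂ (iter F₁₅₂ s e) i     ≡⟨ sparse-shift (iter-sparse sparse s) i ⟩
  iter F₁₅₂ s e (i - + 1)    ≡⟨ iter-sparse-shift sparse s (i - + 1) ⟩
  e ((i - + 1) - + s)        ≡⟨ cong e ([i-1]-j≡i-[1+j] i (+ s)) ⟩
  e (i - + suc s)            ∎
  where open ≡-Reasoning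

diffWithin-translate : ∀ {d c a w} → Sparse d → Sparse c → DiffWithin d c a w →
                       ∀ s → DiffWithin (iter F₁₅₂ s d) (iter F₁₅₂ s c) (a + + s) w
diffWithin-translate {d} {c} {a} sparse-d sparse-c diff s i d≢c
  with window k k<w eq ← diff (i - + s) (λ d≡c → d≢c (trans (iter-sparse-shift sparse-d s i)
                                           (trans d≡c (sym (iter-sparse-shift sparse-c s i))))) =
  window k k<w (trans (sym ([i-j]+j≡i i (+ s))) (trans (cong (_+ + s) eq) (swap a (+ k) (+ s))))
  where swap : ∀ a k s → (a + k) + s ≡ (a + s) + k
        swap = solve-∀

ZeroWithin : ℕ → Config → Set
ZeroWithin L e = ∀ i → ∃[ k ] k ℕ.≤ L × e (i + + k) ≡ false

zeroWithin-mono : ∀ {L L′ e} → L ℕ.≤ L′ → ZeroWithin L e → ZeroWithin L′ e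
zeroWithin-mono L≤L′ zero-within i with k , k≤L , e[i+k]≡0 ← zero-within i =
  k , ℕ.≤-trans k≤L L≤L′ , e[i+k]≡0

falling-edge : ∀ (f : ℕ → Bool) {k} → f 0 ≡ true → f k ≡ false →
               ∃[ j ] j ℕ.< k × f j ≡ true × f (suc j) ≡ false
falling-edge f {zero}  f[0]≡1 f[0]≡0 with () ← trans (sym f[0]≡1) f[0]≡0
falling-edge f {suc k} f[0]≡1 f[1+k]≡0 with f k in f[k]
... | true  = k , ℕ.≤-refl , f[k] , f[1+k]≡0
... | false with j , j<k , rest ← falling-edge f f[0]≡1 f[k] = j , ℕ.m<n⇒m<1+n j<k , rest

zeroWithin-shrink : ∀ {L e} → ZeroWithin (2 ℕ.+ L) e → ZeroWithin (1 ℕ.+ L) (F₁₅₂ e)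
zeroWithin-shrink {L} {e} zero-within i with e i in e[i]
... | true with k , k≤2+L , e[i+k]≡0 ← zero-within i
               with j , j<k , e[i+j]≡1 , e[i+j+1]≡0
                    ← falling-edge (λ j → e (i + + j)) (reindex e (sym (ℤ.+-identityʳ i)) e[i]) e[i+k]≡0 =
  j , s≤s⁻¹ (ℕ.<-≤-trans j<k k≤2+L) ,
  F₁₅₂-·10 e (i + + j) e[i+j]≡1 (reindex e (sym ([i+j]+1≡i+[1+j] i (+ j))) e[i+j+1]≡0)
... | false with e (i + + 1) in e[i+1]
...   | true  = 0 , z≤n ,
  reindex (F₁₅₂ e) (sym (ℤ.+-identityʳ i)) (F₁₅₂-·01 e i e[i] e[i+1])
...   | false = 1 , s≤s z≤n ,
  F₁₅₂-00· e (i + + 1) (reindex e (sym ([i+1]-1≡i i)) e[i]) e[i+1]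

iter-zeroWithin : ∀ {L e} t → ZeroWithin (t ℕ.+ suc L) e → ZeroWithin (suc L) (iter F₁₅₂ t e)
iter-zeroWithin zero zero-within = zero-within
iter-zeroWithin {L} {e} (suc t) zero-within =
  zeroWithin-shrink {e = iter F₁₅₂ t e}
    (iter-zeroWithin t (subst (λ L′ → ZeroWithin L′ e) (sym (ℕ.+-suc t (suc L))) zero-within))

zeroWithin-1⇒isolated : ∀ {e} → ZeroWithin 1 e → Isolated e
zeroWithin-1⇒isolated {e} zero-within i e[i]≡1 with zero-within i
... | 0 , _ , e[i]≡0 with () ← trans (sym e[i]≡1) (reindex e (ℤ.+-identityʳ i) e[i]≡0)
... | 1 , _ , e[i+1]≡0 = e[i+1]≡0
... | suc (suc _) , s≤s () , _

isolated⇒sparse : ∀ {e} → Isolated e → Sparse (F₁₅₂ e)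
isolated⇒sparse {e} isolated i Fe[i]≡1 with F₁₅₂≡1 e i Fe[i]≡1
... | inj₁ (e[i]≡1 , e[i+1]≡1) with () ← trans (sym (isolated i e[i]≡1)) e[i+1]≡1
... | inj₂ (_ , e[i]≡0 , e[i+1]≡0) =
  F₁₅₂-00· e (i + + 1) (reindex e (sym ([i+1]-1≡i i)) e[i]≡0) e[i+1]≡0 ,
  trans (F₁₅₂-shift e (i + + 2) (λ e[i+1]≡1 → contradiction (trans (sym e[i+1]≡1) e[[i+2]-1]≡0) λ ())
                    (isolated (i + + 2)))
        e[[i+2]-1]≡0
  where e[[i+2]-1]≡0 : e ((i + + 2) - + 1) ≡ false
        e[[i+2]-1]≡0 = reindex e (sym ([i+2]-1≡i+1 i)) e[i+1]≡0

sparse-after : ∀ {L e} → ZeroWithin L e → Sparse (iter F₁₅₂ (suc L) e)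
sparse-after {L} {e} zero-within =
  isolated⇒sparse (zeroWithin-1⇒isolated {iter F₁₅₂ L e}
    (iter-zeroWithin L (zeroWithin-mono {e = e} (ℕ.m≤m+n L 1) zero-within)))

diffWithin-zero : ∀ {d c a w j} → DiffWithin d c a w → d j ≡ false → c j ≡ false ⊎ InWindow a w j
diffWithin-zero {c = c} {j = j} diff d[j]≡0 with c j in c[j]
... | false = inj₁ refl
... | true  = inj₂ (diff j λ d≡c → contradiction (trans (sym d[j]≡0) (trans d≡c c[j])) λ ())

-- A zero of d inside the window is replaced by the first zero of d beyond the window.
zeroWithin-agree : ∀ {L d c a w} → ZeroWithin L d → DiffWithin d c a w → ZeroWithin (L ℕ.+ w ℕ.+ L) c
zeroWithin-agree {L} {d} {c} {a} {w} zero-d diff i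
  with k , k≤L , d[i+k]≡0 ← zero-d i
  with diffWithin-zero {c = c} diff d[i+k]≡0
... | inj₁ c[i+k]≡0 = k , ℕ.m≤n⇒m≤n+o L (ℕ.m≤n⇒m≤n+o w k≤L) , c[i+k]≡0
... | inj₂ (window k₁ k₁<w i+k≡a+k₁)
  with k₂ , k₂≤L , d[a+w+k₂]≡0 ← zero-d (a + + w)
  with diffWithin-zero {c = c} diff d[a+w+k₂]≡0
...   | inj₂ in-window = contradiction in-window (¬inWindow-beyond k₂)
...   | inj₁ c[a+w+k₂]≡0 with o , 1+k₁+o≡w ← ℕ.m≤n⇒∃[o]m+o≡n k₁<w =
  k ℕ.+ suc o ℕ.+ k₂ ,
  ℕ.+-mono-≤ (ℕ.+-mono-≤ k≤L 1+o≤w) k₂≤L ,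
  reindex c (sym position) c[a+w+k₂]≡0
  where
    1+o≤w : suc o ℕ.≤ w
    1+o≤w = ℕ.≤-trans (s≤s (ℕ.m≤n+m o k₁)) (ℕ.≤-reflexive 1+k₁+o≡w)
    regroup : ∀ i k o k₂ → i + (k + o + k₂) ≡ (i + k) + o + k₂
    regroup = solve-∀
    position : i + + (k ℕ.+ suc o ℕ.+ k₂) ≡ a + + w + + k₂
    position = begin
      i + + (k ℕ.+ suc o ℕ.+ k₂)    ≡⟨ regroup i (+ k) (+ suc o) (+ k₂) ⟩
      i + + k + + suc o + + k₂      ≡⟨ cong (λ p → p + + suc o + + k₂) i+k≡a+k₁ ⟩
      a + + k₁ + + suc o + + k₂     ≡⟨ cong (_+ + k₂) (ℤ.+-assoc a (+ k₁) (+ suc o)) ⟩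
      a + + (k₁ ℕ.+ suc o) + + k₂   ≡⟨ cong (λ n → a + + n + + k₂) (trans (ℕ.+-suc k₁ o) 1+k₁+o≡w) ⟩
      a + + w + + k₂                ∎
      where open ≡-Reasoning

module _ {K : ℕ} where
  private
    m : ℕ
    m = suc K

  -[N]%ℕ : ∀ N → (- + N) %ℕ m ≡ (m ∸ N % m) % m
  -[N]%ℕ zero = sym (n%n≡0 m)
  -[N]%ℕ (suc n) with suc n % m
  ... | zero  = sym (n%n≡0 m)
  ... | suc s = sym (m<n⇒m%n≡m (s≤s (ℕ.m∸n≤m K s)))

  %ℕ-unique : ∀ {r} Q → r ℕ.< m → (+ r + Q * + m) %ℕ m ≡ r
  %ℕ-unique {r} (+ q) r<m = begin
    (+ r + + q * + m) %ℕ m  ≡⟨ cong (λ z → (+ r + z) %ℕ m) (sym (ℤ.pos-* q m)) ⟩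
    (r ℕ.+ q ℕ.* m) % m     ≡⟨ [m+kn]%n≡m%n r q m ⟩
    r % m                   ≡⟨ m<n⇒m%n≡m r<m ⟩
    r                       ∎
    where open ≡-Reasoning
  %ℕ-unique {r} -[1+ q ] r<m = begin
    (+ r + -[1+ q ] * + m) %ℕ m        ≡⟨ cong (_%ℕ m) (r-[1+q]m≡-[m-r+qm] (+ r) (+ q) (+ m)) ⟩
    (- (+ m - + r + + q * + m)) %ℕ m  ≡⟨ cong (λ z → (- z) %ℕ m) m-r+qm≡m∸r+qm ⟩
    (- + (m ∸ r ℕ.+ q ℕ.* m)) %ℕ m    ≡⟨ -[N]%ℕ (m ∸ r ℕ.+ q ℕ.* m) ⟩
    (m ∸ (m ∸ r ℕ.+ q ℕ.* m) % m) % m ≡⟨ cong (λ z → (m ∸ z) % m) ([m+kn]%n≡m%n (m ∸ r) q m) ⟩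
    (m ∸ (m ∸ r) % m) % m             ≡⟨ m∸[m∸r]%m%m≡r r<m ⟩
    r                                 ∎
    where
      open ≡-Reasoning
      r-[1+q]m≡-[m-r+qm] : ∀ r q m → r + - (+ 1 + q) * m ≡ - ((m - r) + q * m)
      r-[1+q]m≡-[m-r+qm] = solve-∀
      m-r+qm≡m∸r+qm : + m - + r + + q * + m ≡ + (m ∸ r ℕ.+ q ℕ.* m)
      m-r+qm≡m∸r+qm =
        cong₂ _+_ (trans (ℤ.m-n≡m⊖n m r) (ℤ.⊖-≥ (ℕ.<⇒≤ r<m))) (sym (ℤ.pos-* q m))
      m∸[m∸r]%m%m≡r : ∀ {r} → r ℕ.< m → (m ∸ (m ∸ r) % m) % m ≡ r
      m∸[m∸r]%m%m≡r {zero}  _   = trans (cong (λ z → (m ∸ z) % m) (n%n≡0 m)) (n%n≡0 m)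
      m∸[m∸r]%m%m≡r {suc r} r<m = begin
        (m ∸ (K ∸ r) % m) % m  ≡⟨ cong (λ z → (m ∸ z) % m) (m<n⇒m%n≡m (s≤s (ℕ.m∸n≤m K r))) ⟩
        (m ∸ (K ∸ r)) % m      ≡⟨ cong (_% m) (ℕ.m∸[m∸n]≡n (ℕ.<⇒≤ r<m)) ⟩
        suc r % m              ≡⟨ m<n⇒m%n≡m r<m ⟩
        suc r                  ∎

  periodic-lookup : ∀ (u : Vec Bool m) {q} i → i %ℕ m ≡ toℕ q → periodic u i ≡ lookup u q
  periodic-lookup u i i%m≡q = cong (lookup u) (Fin.toℕ-injective (trans (Fin.toℕ-fromℕ< _) i%m≡q))

  periodic-zeroWithin : ∀ (u : Vec Bool m) {q} → lookup u q ≡ false → ZeroWithin K (periodic u)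
  periodic-zeroWithin u {q} u[q]≡0 i =
    k , s≤s⁻¹ (n%ℕd<d X m) , trans (periodic-lookup u (i + + k) i+k%m≡q) u[q]≡0
    where
      open ≡-Reasoning
      X Q : ℤ
      X = + toℕ q - i
      Q = X /ℕ m
      k : ℕ
      k = X %ℕ m
      i+k≡i+[k+Qm]-Qm : ∀ i k Q m → i + k ≡ i + (k + Q * m) - Q * m
      i+k≡i+[k+Qm]-Qm = solve-∀
      i+[q-i]-Qm≡q-Qm : ∀ i q Q m → i + (q - i) - Q * m ≡ q + - Q * m
      i+[q-i]-Qm≡q-Qm = solve-∀
      i+k%m≡q : (i + + k) %ℕ m ≡ toℕ q
      i+k%m≡q = begin
        (i + + k) %ℕ m                       ≡⟨ cong (_%ℕ m) (i+k≡i+[k+Qm]-Qm i (+ k) Q (+ m)) ⟩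
        (i + (+ k + Q * + m) - Q * + m) %ℕ m
          ≡⟨ cong (λ z → (i + z - Q * + m) %ℕ m) (sym (a≡a%ℕn+[a/ℕn]*n X m)) ⟩
        (i + X - Q * + m) %ℕ m               ≡⟨ cong (_%ℕ m) (i+[q-i]-Qm≡q-Qm i (+ toℕ q) Q (+ m)) ⟩
        (+ toℕ q + - Q * + m) %ℕ m           ≡⟨ %ℕ-unique (- Q) (Fin.toℕ<n q) ⟩
        toℕ q                                ∎

module _ {K n : ℕ} (u : Vec Bool (suc K)) (x : Vec Bool n) where
  patch-outside : ∀ j → ¬ j ℕ.< n → patch u x (+ j) ≡ periodic u (+ j)
  patch-outside j j≮n with j <? n
  ... | yes j<n = contradiction j<n j≮n
  ... | no _    = refl

  patch-lookup : ∀ q → patch u x (+ toℕ q) ≡ lookup x q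
  patch-lookup q with toℕ q <? n
  ... | yes q<n = cong (lookup x) (Fin.fromℕ<-toℕ q q<n)
  ... | no q≮n  = contradiction (Fin.toℕ<n q) q≮n

  patch-diffWithin : DiffWithin (periodic u) (patch u x) (+ 0) n
  patch-diffWithin -[1+ _ ] d≢c = contradiction refl d≢c
  patch-diffWithin (+ j) d≢c with j <? n
  ... | yes j<n = window j j<n refl
  ... | no _    = contradiction refl d≢c

-- The all-ones background

record LeftmostZero (e : Config) (z : ℤ) : Set where
  constructor leftmostZero
  field
    zero-at   : e z ≡ false
    ones-left : ∀ k → e (z - + suc k) ≡ true

record RightmostZero (e : Config) (z : ℤ) : Set where
  constructor rightmostZero
  field
    zero-at    : e z ≡ false
    ones-right : ∀ k → e (z + + suc k) ≡ true

leftmostZero-step : ∀ {e z} → LeftmostZero e z → LeftmostZero (F₁₅₂ e) (z - + 1)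
leftmostZero-step {e} {z} (leftmostZero e[z]≡0 ones) = leftmostZero
  (F₁₅₂-·10 e (z - + 1) (ones 0) (reindex e (sym ([i-1]+1≡i z)) e[z]≡0))
  λ k → F₁₅₂-·11 e ((z - + 1) - + suc k)
          (reindex e (sym ([i-1]-j≡i-[1+j] z (+ suc k))) (ones (suc k)))
          (reindex e (sym ([[i-1]-j]+1≡i-j z (+ suc k))) (ones k))
  where [[i-1]-j]+1≡i-j : ∀ i j → ((i - + 1) - j) + + 1 ≡ i - j
        [[i-1]-j]+1≡i-j = solve-∀

iter-leftmostZero : ∀ {e z} → LeftmostZero e z → ∀ t → LeftmostZero (iter F₁₅₂ t e) (z - + t)
iter-leftmostZero {e} {z} leftmost zero = subst (LeftmostZero e) (sym (ℤ.+-identityʳ z)) leftmost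
iter-leftmostZero {e} {z} leftmost (suc t) =
  subst (LeftmostZero _) ([i-j]-1≡i-[1+j] z (+ t)) (leftmostZero-step (iter-leftmostZero leftmost t))

rightmostZero-step : ∀ {e z} → RightmostZero e z → RightmostZero (F₁₅₂ e) z
rightmostZero-step {e} {z} (rightmostZero e[z]≡0 ones) = rightmostZero
  (F₁₅₂-·01 e z e[z]≡0 (ones 0))
  λ k → F₁₅₂-·11 e (z + + suc k) (ones k) (reindex e (sym ([i+j]+1≡i+[1+j] z (+ suc k))) (ones (suc k)))

iter-rightmostZero : ∀ {e z} → RightmostZero e z → ∀ t → RightmostZero (iter F₁₅₂ t e) z
iter-rightmostZero rightmost zero    = rightmost
iter-rightmostZero rightmost (suc t) = rightmostZero-step (iter-rightmostZero rightmost t)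

iter-ones : ∀ {e} → (∀ i → e i ≡ true) → ∀ t i → iter F₁₅₂ t e i ≡ true
iter-ones ones zero    i = ones i
iter-ones {e} ones (suc t) i =
  F₁₅₂-·11 (iter F₁₅₂ t e) i (iter-ones ones t i) (iter-ones ones t (i + + 1))

leftmost-false : ∀ (f : ℕ → Bool) j → f j ≡ false →
                 ∃[ m ] f m ≡ false × (∀ i → i ℕ.< m → f i ≡ true)
leftmost-false f zero    f[0]≡0 = 0 , f[0]≡0 , λ _ ()
leftmost-false f (suc j) f[1+j]≡0 with f 0 in f[0]
... | false = 0 , f[0] , λ _ ()
... | true with m , f[1+m]≡0 , below ← leftmost-false (f ∘ suc) j f[1+j]≡0 =
  suc m , f[1+m]≡0 , λ { zero _ → f[0] ; (suc i) i<m → below i (s≤s⁻¹ i<m) }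

rightmost-false : ∀ (f : ℕ → Bool) n {j} → f j ≡ false → (∀ i → n ℕ.≤ i → f i ≡ true) →
                  ∃[ s ] f s ≡ false × (∀ i → s ℕ.< i → f i ≡ true)
rightmost-false f zero    f[j]≡0 above with () ← trans (sym f[j]≡0) (above _ z≤n)
rightmost-false f (suc n) f[j]≡0 above with f n in f[n]
... | false = n , f[n] , above
... | true  = rightmost-false f n f[j]≡0 above′
  where above′ : ∀ i → n ℕ.≤ i → f i ≡ true
        above′ i n≤i with ℕ.m≤n⇒m<n∨m≡n n≤i
        ... | inj₁ n<i  = above i n<i
        ... | inj₂ refl = f[n]

AllOnes : ∀ {n} → Vec Bool n → Set
AllOnes = All (_≡ true)

allOnes? : ∀ {n} → Decidable (AllOnes {n})
allOnes? = all? (Bool._≟ true)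

allOnes-or-zero : ∀ {n} (v : Vec Bool n) → AllOnes v ⊎ ∃[ q ] lookup v q ≡ false
allOnes-or-zero []          = inj₁ []
allOnes-or-zero (false ∷ v) = inj₂ (zero , refl)
allOnes-or-zero (true ∷ v) with allOnes-or-zero v
... | inj₁ ones         = inj₁ (refl ∷ ones)
... | inj₂ (q , v[q]≡0) = inj₂ (suc q , v[q]≡0)

module _ {K n : ℕ} {u : Vec Bool (suc K)} (u-ones : AllOnes u) (x : Vec Bool n) where
  private
    c : Config
    c = patch u x

  periodic-ones : ∀ i → periodic u i ≡ true
  periodic-ones i = All.lookup⁺ u-ones (fromℕ< (n%ℕd<d i (suc K)))

  patch-ones : AllOnes x → ∀ i → c i ≡ true
  patch-ones x-ones i@(-[1+ _ ]) = periodic-ones i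
  patch-ones x-ones (+ j) with j <? n
  ... | yes _ = All.lookup⁺ x-ones _
  ... | no _  = periodic-ones (+ j)

  sinv-of-allOnes : AllOnes x → SInvP F₁₅₂ u x
  sinv-of-allOnes x-ones = 0 , λ t → + 0 , λ i d≢c →
    contradiction (trans (iter-ones periodic-ones t i) (sym (iter-ones (patch-ones x-ones) t i))) d≢c

  -- The leftmost zero drifts left at speed one while the rightmost zero stays put.
  sinv⇒zeros-ordered : ∀ {l r} → LeftmostZero c l → RightmostZero c r → SInvP F₁₅₂ u x → r ℤ.< l
  sinv⇒zeros-ordered {l} {r} leftmost rightmost (w , bounded) with a , diff-bounded ← bounded w =
    ℤ.<-≤-trans r<a+w (subst (a + + w ℤ.≤_) ([i-j]+j≡i l (+ w)) (ℤ.+-monoˡ-≤ (+ w) a≤l-w))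
    where
      differs : ∀ {i} → iter F₁₅₂ w c i ≡ false → iter F₁₅₂ w (periodic u) i ≢ iter F₁₅₂ w c i
      differs {i} c[i]≡0 d≡c =
        contradiction (trans (sym (iter-ones periodic-ones w i)) (trans d≡c c[i]≡0)) λ ()
      a≤l-w : a ℤ.≤ l - + w
      a≤l-w = proj₁ (diff-bounded _ (differs (LeftmostZero.zero-at (iter-leftmostZero leftmost w))))
      r<a+w : r ℤ.< a + + w
      r<a+w = proj₂ (diff-bounded _ (differs (RightmostZero.zero-at (iter-rightmostZero rightmost w))))

  ones-beyond : ∀ j → n ℕ.≤ j → c (+ j) ≡ true
  ones-beyond j n≤j = trans (patch-outside u x j (ℕ.≤⇒≯ n≤j)) (periodic-ones (+ j))

  ¬sinv-zero : ∀ {j} → c (+ j) ≡ false → ¬ SInvP F₁₅₂ u x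
  ¬sinv-zero {j} c[j]≡0 sinv
    with m , c[m]≡0 , ones-below ← leftmost-false (c ∘ +_) j c[j]≡0
    with s , c[s]≡0 , ones-above ← rightmost-false (c ∘ +_) n c[j]≡0 ones-beyond =
    contradiction (trans (sym c[m]≡0) (ones-above m s<m)) λ ()
    where
      ones-left : ∀ i → i ℤ.< + m → c i ≡ true
      ones-left i@(-[1+ _ ]) _ = periodic-ones i
      ones-left (+ i)      i<m = ones-below i (ℤ.drop‿+<+ i<m)
      leftmost : LeftmostZero c (+ m)
      leftmost = leftmostZero c[m]≡0 λ k → ones-left _ (ℤ.m⊖1+n<m m (suc k))
      rightmost : RightmostZero c (+ s)
      rightmost = rightmostZero c[s]≡0 λ k → ones-above (s ℕ.+ suc k) (ℕ.m<m+n s ℕ.z<s)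
      s<m : s ℕ.< m
      s<m = ℤ.drop‿+<+ (sinv⇒zeros-ordered leftmost rightmost sinv)

  sinv⇔allOnes : SInvP F₁₅₂ u x ⇔ AllOnes x
  sinv⇔allOnes = mk⇔ to sinv-of-allOnes
    where to : SInvP F₁₅₂ u x → AllOnes x
          to sinv with allOnes-or-zero x
          ... | inj₁ x-ones       = x-ones
          ... | inj₂ (q , x[q]≡0) = contradiction sinv (¬sinv-zero (trans (patch-lookup u x q) x[q]≡0))

module _ {K : ℕ} {u : Vec Bool (suc K)} {q} (u[q]≡0 : lookup u q ≡ false) {n : ℕ} (x : Vec Bool n) where
  private
    d c : Config
    d = periodic u
    c = patch u x
    -- both configurations are sparse from time T on
    L T : ℕ
    L = K ℕ.+ n ℕ.+ K
    T = suc L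

  sinv-if-u-has-zero : SInvP F₁₅₂ u x
  sinv-if-u-has-zero = n ℕ.+ 2 ℕ.* T , bounded
    where
      zero-d : ZeroWithin K d
      zero-d = periodic-zeroWithin u u[q]≡0
      early : ∀ t → DiffWithin (iter F₁₅₂ t d) (iter F₁₅₂ t c) (+ 0 - + t) (n ℕ.+ 2 ℕ.* t)
      early = lightcone 152 (patch-diffWithin u x)
      late : ∀ s → DiffWithin (iter F₁₅₂ s (iter F₁₅₂ T d)) (iter F₁₅₂ s (iter F₁₅₂ T c))
                              (+ 0 - + T + + s) (n ℕ.+ 2 ℕ.* T)
      late = diffWithin-translate
        (sparse-after {e = d} (zeroWithin-mono {e = d} (ℕ.m≤n+m K (K ℕ.+ n)) zero-d))
        (sparse-after {e = c} (zeroWithin-agree zero-d (patch-diffWithin u x)))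
        (early T)
      bounded : ∀ t → ∃[ a ] ∀ i → iter F₁₅₂ t d i ≢ iter F₁₅₂ t c i →
                  a ℤ.≤ i × i ℤ.< a + + (n ℕ.+ 2 ℕ.* T)
      bounded t with ℕ.≤-total t T
      ... | inj₁ t≤T =
        _ , λ i → inWindow⇒bounds ∘ inWindow-widen (ℕ.+-monoʳ-≤ n (ℕ.*-monoʳ-≤ 2 t≤T)) ∘ early t i
      ... | inj₂ T≤t = _ , λ i d≢c → inWindow⇒bounds (late (t ∸ T) i (d≢c ∘ λ d≡c →
        trans (cong-app (iter-∸ F₁₅₂ T≤t d) i)
              (trans d≡c (sym (cong-app (iter-∸ F₁₅₂ T≤t c) i)))))

conjunction : ∀ {X Y : Set} → (X → Bool) → (Y → Bool) → Protocol X Y Bool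
conjunction f g = alice f (bob g (leaf true) (leaf false)) (leaf false)

conjunction-correct : ∀ {ℓ} {X Y : Set} {P : Pred X ℓ} {Q : Pred Y ℓ}
  (P? : Decidable P) (Q? : Decidable Q) x y →
  (eval (conjunction (does ∘ P?) (does ∘ Q?)) x y ≡ true) ⇔ (P x × Q y)
conjunction-correct P? Q? x y with P? x
... | no ¬p = mk⇔ (λ ()) (⊥-elim ∘ ¬p ∘ proj₁)
... | yes p with Q? y
...   | yes q = mk⇔ (λ _ → p , q) (λ _ → refl)
...   | no ¬q = mk⇔ (λ ()) (⊥-elim ∘ ¬q ∘ proj₂)

allOnes-++ : ∀ {i j} (x : Vec Bool i) (y : Vec Bool j) → (AllOnes x × AllOnes y) ⇔ AllOnes (x ++ y)
allOnes-++ x y = mk⇔ (λ (x-ones , y-ones) → All.++⁺ x-ones y-ones) (All.++⁻ x)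

proposition19 : ∀ {k} (u : Vec Bool (suc k)) →
    ∃[ c ] ∃[ N ] ∀ (n : ℕ) → n ≥ N → SInvD≤ (ECA 152) u n c
proposition19 u with allOnes-or-zero u
... | inj₁ u-ones = 2 , 0 , λ _ _ _ _ _ → conjunction (does ∘ allOnes?) (does ∘ allOnes?) , ℕ.≤-refl ,
  λ x y → ⇔.trans (conjunction-correct allOnes? allOnes? x y)
                  (⇔.trans (allOnes-++ x y) (⇔.sym (sinv⇔allOnes u-ones (x ++ y))))
... | inj₂ (_ , u[q]≡0) = 0 , 0 , λ _ _ _ _ _ → leaf true , z≤n ,
  λ x y → mk⇔ (λ _ → sinv-if-u-has-zero u[q]≡0 (x ++ y)) (λ _ → refl)
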